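{- Let $V$ be a finite set and $E_1,E_2$ equivalence relations on $V$. Then there is no pair $(E_1',E_2')\neq(E_1,E_2)$ of equivalence relations on $V$ with $\mathbf{l}_{E_2'}(\mathbf{l}_{E_1'}(X))=\mathbf{l}_{E_2}(\mathbf{l}_{E_1}(X))$ for all $X\subseteq V$ if and only if: (i) for all $E_2$-classes $[x]_{E_2}\neq[y]_{E_2}$: $\mathbf{u}_{E_1}([x]_{E_2})\neq\mathbf{u}_{E_1}([y]_{E_2})$; (ii) for all $E_1$-classes $[x]_{E_1}\neq[y]_{E_1}$: $\mathbf{u}_{E_2}([x]_{E_1})\neq\mathbf{u}_{E_2}([y]_{E_1})$; (iii) for every $E_2$-class $[x]_{E_2}$ and all $Y,Z\subseteq V$ with $[x]_{E_2}=Y\cup Z$ and $Y\cap Z=\emptyset$: $\mathbf{u}_{E_1}(Y)\neq\mathbf{u}_{E_1}(Z)$; (iv) for every $E_1$-class $[x]_{E_1}$ and all $Y,Z\subseteq V$ with $[x]_{E_1}=Y\cup Z$ and $Y\cap Z=\emptyset$: $\mathbf{u}_{E_2}(Y)\neq\mathbf{u}_{E_2}(Z)$.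
   Context: For an equivalence relation $E$ on $V$: $\mathbf{l}_E(X)=\{x:[x]_E\subseteq X\}$ and $\mathbf{u}_E(X)=\{x:[x]_E\cap X\neq\emptyset\}$. -}

module Defs where

open import Data.Nat using (ℕ)
open import Data.Bool using (Bool; true; false; not; _∧_; _∨_)
open import Data.Fin using (Fin)
open import Data.Fin.Subset using (Subset)
open import Data.List using (allFin)
open import Data.Bool.ListAction using (all; any)
open import Data.Vec using (tabulate; lookup)
open import Data.Product using (_×_)
open import Relation.Binary.PropositionalEquality using (_≡_)

-- The finite set V is Fin n.  A (decidable) binary relation on V:
BRel : ℕ → Set
BRel n = Fin n → Fin n → Bool

record IsEquivRel {n : ℕ} (E : BRel n) : Set where
  field
    reflE  : ∀ x → E x x ≡ true
    symE   : ∀ x y → E x y ≡ true → E y x ≡ true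
    transE : ∀ x y z → E x y ≡ true → E y z ≡ true → E x z ≡ true

_≐_ : {n : ℕ} → BRel n → BRel n → Set
E ≐ F = ∀ x y → E x y ≡ F x y

cls : {n : ℕ} → BRel n → Fin n → Subset n
cls E x = tabulate (E x)

lowerA : {n : ℕ} → BRel n → Subset n → Subset n
lowerA {n} E X = tabulate λ x → all (λ y → not (E x y) ∨ lookup X y) (allFin n)

upperA : {n : ℕ} → BRel n → Subset n → Subset n
upperA {n} E X = tabulate λ x → any (λ y → E x y ∧ lookup X y) (allFin n)

-- x ∈ l_{E₂}(l_{E₁}(X)) iff X contains every z reachable from x by an E₂-step followed by an
-- E₁-step, so X ↦ l_{E₂}(l_{E₁}(X)) and the composite relation E₂ ⨾ E₁ determine each other;
-- the image of x under E₂ ⨾ E₁ is u_{E₁}([x]_{E₂}). If (i) fails, gluing two E₂-classes with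
-- the same image leaves the composite unchanged; if (iii) fails, so does splitting an E₂-class
-- into two parts with the same upper approximation. Conversely, if E₂′ ⨾ E₁′ = E₂ ⨾ E₁, then
-- (i) forces E₂′ ⊆ E₂ (and (ii) E₁′ ⊆ E₁), and then (iii) forces E₂ ⊆ E₂′: otherwise [x]_{E₂′}
-- and the rest of [x]_{E₂} would split [x]_{E₂} with equal upper approximations. Transposing
-- the composite exchanges the roles of E₁ and E₂.

module Submission where

open import Defs
open import Level using (0ℓ)
open import Data.Nat using (ℕ)
open import Data.Bool using (Bool; true; false; not; _∧_; _∨_; T)
open import Data.Bool.Properties using (T-≡; T-∧; T-∨; ⇔→≡; _≟_)
open import Data.Empty using (⊥-elim)
open import Data.Fin using (Fin)
open import Data.Fin.Subset using (Subset; _∪_; _∩_; ⊥; ∁; _∈_; _∉_; _⊆_)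
open import Data.Fin.Subset.Properties
  using (_∈?_; ⊆-antisym; ⊆-reflexive; ⊥⊆; ∉⊥; x∈p∪q⁺; x∈p∪q⁻; x∈p∩q⁺; x∈p∩q⁻;
         x∈∁p⇒x∉p; x∉p⇒x∈∁p; ∪-comm; ∩-comm)
open import Data.List using (allFin)
open import Data.List.Membership.Propositional using (lose)
open import Data.List.Membership.Propositional.Properties using (∈-allFin)
import Data.List.Relation.Unary.All as All
open import Data.List.Relation.Unary.All.Properties using (all⁺; all⁻)
open import Data.List.Relation.Unary.Any using (satisfied)
open import Data.List.Relation.Unary.Any.Properties using (any⁺; any⁻)
open import Data.Product using (_×_; _,_; proj₁; proj₂; ∃-syntax)
open import Data.Sum as Sum using (_⊎_; inj₁; inj₂; [_,_])
open import Data.Vec using (tabulate; lookup)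
open import Data.Vec.Properties using (lookup∘tabulate; []=⇒lookup; lookup⇒[]=)
open import Function using (_∘_)
open import Function.Bundles using (_⇔_; mk⇔; Equivalence)
open import Function.Properties.Equivalence using (⇔-isEquivalence)
open import Relation.Binary.Core using (Rel; _⇒_)
open import Relation.Binary.Structures using (IsEquivalence)
open import Relation.Binary.PropositionalEquality using (_≡_; _≢_; refl; sym; trans; cong; subst)
open import Relation.Nullary using (¬_; yes; no)
open import Relation.Nullary.Decidable using (decidable-stable; ⌊_⌋; toWitness; fromWitness)

open Equivalence using (to; from)

private
  variable
    n : ℕ
    E E₁ E₂ E₁′ E₂′ F : BRel n
    X C : Subset n
    x y z : Fin n

∈-tabulate : {f : Fin n → Bool} → x ∈ tabulate f ⇔ f x ≡ true
∈-tabulate {x = x} {f = f} = mk⇔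
  (λ x∈ → trans (sym (lookup∘tabulate f x)) ([]=⇒lookup x∈))
  (λ fx → lookup⇒[]= x _ (trans (lookup∘tabulate f x) fx))

T-lookup : T (lookup X x) ⇔ x ∈ X
T-lookup = mk⇔ (lookup⇒[]= _ _ ∘ to T-≡) (from T-≡ ∘ []=⇒lookup)

lookup-≡⇔∈-⇔ : lookup X x ≡ lookup X y ⇔ (x ∈ X ⇔ y ∈ X)
lookup-≡⇔∈-⇔ = mk⇔
  (λ eq → mk⇔ (λ x∈ → lookup⇒[]= _ _ (trans (sym eq) ([]=⇒lookup x∈)))
              (λ y∈ → lookup⇒[]= _ _ (trans eq ([]=⇒lookup y∈))))
  (λ iff → ⇔→≡ (mk⇔ ([]=⇒lookup ∘ to iff ∘ lookup⇒[]= _ _)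
                    ([]=⇒lookup ∘ from iff ∘ lookup⇒[]= _ _)))

T-not-∨ : ∀ {a b} → T (not a ∨ b) ⇔ (T a → T b)
T-not-∨ {true}  = mk⇔ (λ b _ → b) (λ a⇒b → a⇒b _)
T-not-∨ {false} = mk⇔ (λ _ ()) _

q≡p∪[q∩∁p] : {p q : Subset n} → p ⊆ q → q ≡ p ∪ (q ∩ ∁ p)
q≡p∪[q∩∁p] {p = p} {q} p⊆q = ⊆-antisym (x∈p∪q⁺ ∘ side)
  (λ x∈ → [ p⊆q , proj₁ ∘ x∈p∩q⁻ q (∁ p) ] (x∈p∪q⁻ p (q ∩ ∁ p) x∈))
  where
  side : x ∈ q → x ∈ p ⊎ x ∈ q ∩ ∁ p
  side {x} x∈q with x ∈? p
  ... | yes x∈p = inj₁ x∈p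
  ... | no  x∉p = inj₂ (x∈p∩q⁺ (x∈q , x∉p⇒x∈∁p x∉p))

p∩[q∩∁p]≡⊥ : {p q : Subset n} → p ∩ (q ∩ ∁ p) ≡ ⊥
p∩[q∩∁p]≡⊥ {p = p} {q} = ⊆-antisym
  (λ x∈ → let x∈p , x∈q∩∁p = x∈p∩q⁻ p (q ∩ ∁ p) x∈
          in ⊥-elim (x∈∁p⇒x∉p (proj₂ (x∈p∩q⁻ q (∁ p) x∈q∩∁p)) x∈p))
  ⊥⊆

∉-disjoint : {p q : Subset n} → p ∩ q ≡ ⊥ → x ∈ p → x ∉ q
∉-disjoint p∩q≡⊥ x∈p x∈q = ∉⊥ (subst (_ ∈_) p∩q≡⊥ (x∈p∩q⁺ (x∈p , x∈q)))

⟦_⟧ : BRel n → Rel (Fin n) 0ℓ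
⟦ E ⟧ x y = E x y ≡ true

isEquivalence : IsEquivRel E → IsEquivalence ⟦ E ⟧
isEquivalence e = record
  { refl  = reflE _
  ; sym   = symE _ _
  ; trans = transE _ _ _
  }
  where open IsEquivRel e

isEquivRel : IsEquivalence ⟦ E ⟧ → IsEquivRel E
isEquivRel eq = record
  { reflE  = λ _ → IsEquivalence.refl eq
  ; symE   = λ _ _ → IsEquivalence.sym eq
  ; transE = λ _ _ _ → IsEquivalence.trans eq
  }

⇒-antisym : ⟦ E ⟧ ⇒ ⟦ F ⟧ → ⟦ F ⟧ ⇒ ⟦ E ⟧ → E ≐ F
⇒-antisym E⇒F F⇒E x y = ⇔→≡ (mk⇔ E⇒F F⇒E)

_⇔ᴿ_ : Rel (Fin n) 0ℓ → Rel (Fin n) 0ℓ → Set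
R ⇔ᴿ S = ∀ {x y} → R x y ⇔ S x y

record _⨾_ (E₂ E₁ : BRel n) (x z : Fin n) : Set where
  constructor via
  field
    {mid}  : Fin n
    first  : ⟦ E₂ ⟧ x mid
    second : ⟦ E₁ ⟧ mid z

∈-cls : (E : BRel n) → y ∈ cls E x ⇔ ⟦ E ⟧ x y
∈-cls E = ∈-tabulate

cls-closed : IsEquivalence ⟦ E ⟧ → ⟦ E ⟧ x y → x ∈ cls E z → y ∈ cls E z
cls-closed {E = E} eq xy x∈ = from (∈-cls E) (IsEquivalence.trans eq (to (∈-cls E) x∈) xy)

related⇒cls≡ : IsEquivalence ⟦ E ⟧ → ⟦ E ⟧ x y → cls E x ≡ cls E y
related⇒cls≡ {E = E} eq xy = ⊆-antisym
  (λ w∈ → from (∈-cls E) (Eq.trans (Eq.sym xy) (to (∈-cls E) w∈)))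
  (λ w∈ → from (∈-cls E) (Eq.trans xy (to (∈-cls E) w∈)))
  where module Eq = IsEquivalence eq

cls≡⇒related : IsEquivalence ⟦ E ⟧ → cls E x ≡ cls E y → ⟦ E ⟧ x y
cls≡⇒related {E = E} eq cx≡cy =
  to (∈-cls E) (subst (_ ∈_) (sym cx≡cy) (from (∈-cls E) (IsEquivalence.refl eq)))

∈-lowerA : (E : BRel n) → x ∈ lowerA E X ⇔ (∀ {y} → ⟦ E ⟧ x y → y ∈ X)
∈-lowerA {n = n} {x = x} {X = X} E = mk⇔
  (λ x∈ {y} xy →
     let all-p = all⁺ p (allFin n) (from T-≡ (to ∈-tabulate x∈))
     in to T-lookup (to T-not-∨ (All.lookup all-p (∈-allFin y)) (from T-≡ xy)))
  (λ x⇒X → from ∈-tabulate (to T-≡ (all⁻ p {xs = allFin n}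
     (All.tabulate λ _ → from T-not-∨ (from T-lookup ∘ x⇒X ∘ to T-≡)))))
  where
  p : Fin n → Bool
  p y = not (E x y) ∨ lookup X y

∈-upperA : (E : BRel n) → x ∈ upperA E X ⇔ (∃[ y ] ⟦ E ⟧ x y × y ∈ X)
∈-upperA {n = n} {x = x} {X = X} E = mk⇔
  (λ x∈ → let y , t = satisfied (any⁻ p (allFin n) (from T-≡ (to ∈-tabulate x∈)))
              xy , y∈ = to T-∧ t
          in y , to T-≡ xy , to T-lookup y∈)
  (λ (y , xy , y∈) → from ∈-tabulate (to T-≡
     (any⁺ p (lose (∈-allFin y) (from T-∧ (from T-≡ xy , from T-lookup y∈))))))
  where
  p : Fin n → Bool
  p y = E x y ∧ lookup X y

∈-lowerA-lowerA : x ∈ lowerA E₂ (lowerA E₁ X) ⇔ (∀ {z} → (E₂ ⨾ E₁) x z → z ∈ X)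
∈-lowerA-lowerA {E₂ = E₂} {E₁ = E₁} = mk⇔
  (λ x∈ {_} (via xy yz) → to (∈-lowerA E₁) (to (∈-lowerA E₂) x∈ xy) yz)
  (λ x⇒X → from (∈-lowerA E₂) λ xy → from (∈-lowerA E₁) λ yz → x⇒X (via xy yz))

∈-upperA-cls : IsEquivalence ⟦ E₁ ⟧ → z ∈ upperA E₁ (cls E₂ x) ⇔ (E₂ ⨾ E₁) x z
∈-upperA-cls {E₁ = E₁} {E₂ = E₂} eq₁ = mk⇔
  (λ z∈ → let _ , zy , y∈ = to (∈-upperA E₁) z∈ in via (to (∈-cls E₂) y∈) (Eq₁.sym zy))
  (λ (via {y} xy yz) → from (∈-upperA E₁) (y , Eq₁.sym yz , from (∈-cls E₂) xy))
  where module Eq₁ = IsEquivalence eq₁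

upperA-cls-≡ : IsEquivalence ⟦ E₁ ⟧ →
  (∀ {z} → (E₂ ⨾ E₁) x z → (E₂ ⨾ E₁) y z) → (∀ {z} → (E₂ ⨾ E₁) y z → (E₂ ⨾ E₁) x z) →
  upperA E₁ (cls E₂ x) ≡ upperA E₁ (cls E₂ y)
upperA-cls-≡ {E₁ = E₁} {E₂ = E₂} {x = x} {y = y} eq₁ x⇒y y⇒x = ⊆-antisym
  (λ z∈ → from (∈-upperA-cls eq₁) (x⇒y (to (∈-upperA-cls {E₂ = E₂} {x = x} eq₁) z∈)))
  (λ z∈ → from (∈-upperA-cls eq₁) (y⇒x (to (∈-upperA-cls {E₂ = E₂} {x = y} eq₁) z∈)))

lowerA-lowerA-antitone : (E₂′ ⨾ E₁′) ⇒ (E₂ ⨾ E₁) →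
  lowerA E₂ (lowerA E₁ X) ⊆ lowerA E₂′ (lowerA E₁′ X)
lowerA-lowerA-antitone {X = X} R′⇒R x∈ =
  from (∈-lowerA-lowerA {X = X}) (to (∈-lowerA-lowerA {X = X}) x∈ ∘ R′⇒R)

-- Test the inclusion on the image of x under E₂ ⨾ E₁.
lowerA-lowerA-antitone⁻ : IsEquivalence ⟦ E₁ ⟧ →
  (∀ X → lowerA E₂ (lowerA E₁ X) ⊆ lowerA E₂′ (lowerA E₁′ X)) →
  (E₂′ ⨾ E₁′) ⇒ (E₂ ⨾ E₁)
lowerA-lowerA-antitone⁻ {E₁ = E₁} {E₂ = E₂} eq₁ L⊆L′ {x} r′ =
  to (∈-upperA-cls eq₁) (to ∈-lowerA-lowerA (L⊆L′ image x∈) r′)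
  where
  image : Subset _
  image = upperA E₁ (cls E₂ x)
  x∈ : x ∈ lowerA E₂ (lowerA E₁ image)
  x∈ = from ∈-lowerA-lowerA (from (∈-upperA-cls eq₁))

lowerA-lowerA-≡⇒⨾-⇔ᴿ : IsEquivalence ⟦ E₁ ⟧ → IsEquivalence ⟦ E₁′ ⟧ →
  (∀ X → lowerA E₂′ (lowerA E₁′ X) ≡ lowerA E₂ (lowerA E₁ X)) → (E₂ ⨾ E₁) ⇔ᴿ (E₂′ ⨾ E₁′)
lowerA-lowerA-≡⇒⨾-⇔ᴿ eq₁ eq₁′ L′≡L = mk⇔
  (lowerA-lowerA-antitone⁻ eq₁′ (⊆-reflexive ∘ L′≡L))
  (lowerA-lowerA-antitone⁻ eq₁ (⊆-reflexive ∘ sym ∘ L′≡L))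

⨾-⇔ᴿ⇒lowerA-lowerA-≡ : (E₂ ⨾ E₁) ⇔ᴿ (E₂′ ⨾ E₁′) →
  ∀ X → lowerA E₂′ (lowerA E₁′ X) ≡ lowerA E₂ (lowerA E₁ X)
⨾-⇔ᴿ⇒lowerA-lowerA-≡ R⇔R′ X =
  ⊆-antisym (lowerA-lowerA-antitone {X = X} (to R⇔R′)) (lowerA-lowerA-antitone {X = X} (from R⇔R′))

⨾-transpose : IsEquivalence ⟦ E₁ ⟧ → IsEquivalence ⟦ E₂ ⟧ → (E₂ ⨾ E₁) x z → (E₁ ⨾ E₂) z x
⨾-transpose eq₁ eq₂ (via xy yz) = via (IsEquivalence.sym eq₁ yz) (IsEquivalence.sym eq₂ xy)

⨾-⇔ᴿ-transpose : IsEquivalence ⟦ E₁ ⟧ → IsEquivalence ⟦ E₂ ⟧ →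
  IsEquivalence ⟦ E₁′ ⟧ → IsEquivalence ⟦ E₂′ ⟧ →
  (E₂ ⨾ E₁) ⇔ᴿ (E₂′ ⨾ E₁′) → (E₁ ⨾ E₂) ⇔ᴿ (E₁′ ⨾ E₂′)
⨾-⇔ᴿ-transpose eq₁ eq₂ eq₁′ eq₂′ R⇔R′ = mk⇔
  (⨾-transpose eq₁′ eq₂′ ∘ to R⇔R′ ∘ ⨾-transpose eq₂ eq₁)
  (⨾-transpose eq₁ eq₂ ∘ from R⇔R′ ∘ ⨾-transpose eq₂′ eq₁′)

⨾-respectsˡ : IsEquivalence ⟦ E₂ ⟧ → ⟦ E₂ ⟧ x y → (E₂ ⨾ E₁) x z → (E₂ ⨾ E₁) y z
⨾-respectsˡ eq₂ xy (via xw wz) = via (IsEquivalence.trans eq₂ (IsEquivalence.sym eq₂ xy) xw) wz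

upperA-≡-witness : {P Q : Subset n} → IsEquivalence ⟦ E ⟧ → upperA E P ≡ upperA E Q →
  x ∈ P → ⟦ E ⟧ x z → ∃[ y ] y ∈ Q × ⟦ E ⟧ y z
upperA-≡-witness {E = E} eq uP≡uQ x∈P xz =
  let y , zy , y∈Q = to (∈-upperA E) (subst (_ ∈_) uP≡uQ (from (∈-upperA E) (_ , Eq.sym xz , x∈P)))
  in y , y∈Q , Eq.sym zy
  where module Eq = IsEquivalence eq

ClassesSeparated : BRel n → BRel n → Set
ClassesSeparated {n} E₁ E₂ =
  (x y : Fin n) → cls E₂ x ≢ cls E₂ y → upperA E₁ (cls E₂ x) ≢ upperA E₁ (cls E₂ y)

ClassesUnsplittable : BRel n → BRel n → Set
ClassesUnsplittable {n} E₁ E₂ =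
  (x : Fin n) (Y Z : Subset n) → cls E₂ x ≡ Y ∪ Z → Y ∩ Z ≡ ⊥ → upperA E₁ Y ≢ upperA E₁ Z

⇒-of-separated : IsEquivalence ⟦ E₁ ⟧ → IsEquivalence ⟦ E₂ ⟧ → IsEquivalence ⟦ E₂′ ⟧ →
  (E₂ ⨾ E₁) ⇔ᴿ (E₂′ ⨾ E₁′) → ClassesSeparated E₁ E₂ → ⟦ E₂′ ⟧ ⇒ ⟦ E₂ ⟧
⇒-of-separated {E₁ = E₁} {E₂ = E₂} {E₂′ = E₂′} eq₁ eq₂ eq₂′ R⇔R′ separated {x} {y} xy′ =
  decidable-stable (E₂ x y ≟ true) λ ¬xy →
    separated x y (¬xy ∘ cls≡⇒related eq₂)
      (upperA-cls-≡ eq₁ (move xy′) (move (IsEquivalence.sym eq₂′ xy′)))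
  where
  move : ∀ {a b z} → ⟦ E₂′ ⟧ a b → (E₂ ⨾ E₁) a z → (E₂ ⨾ E₁) b z
  move ab = from R⇔R′ ∘ ⨾-respectsˡ eq₂′ ab ∘ to R⇔R′

⇐-of-unsplittable : IsEquivalence ⟦ E₁ ⟧ → IsEquivalence ⟦ E₂ ⟧ → IsEquivalence ⟦ E₂′ ⟧ →
  (E₂ ⨾ E₁) ⇔ᴿ (E₂′ ⨾ E₁′) → ⟦ E₁′ ⟧ ⇒ ⟦ E₁ ⟧ → ⟦ E₂′ ⟧ ⇒ ⟦ E₂ ⟧ →
  ClassesUnsplittable E₁ E₂ → ⟦ E₂ ⟧ ⇒ ⟦ E₂′ ⟧
⇐-of-unsplittable {E₁ = E₁} {E₂ = E₂} {E₂′ = E₂′}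
                  eq₁ eq₂ eq₂′ R⇔R′ E₁′⇒E₁ E₂′⇒E₂ unsplittable {x} {a} xa =
  decidable-stable (E₂′ x a ≟ true) λ ¬xa′ →
    unsplittable x Y Z (q≡p∪[q∩∁p] Y⊆cls) p∩[q∩∁p]≡⊥ (⊆-antisym (uY⊆uZ ¬xa′) uZ⊆uY)
  where
  module Eq₁ = IsEquivalence eq₁
  module Eq₂ = IsEquivalence eq₂
  module Eq₂′ = IsEquivalence eq₂′
  Y Z : Subset _
  Y = cls E₂′ x
  Z = cls E₂ x ∩ ∁ Y
  Y⊆cls : Y ⊆ cls E₂ x
  Y⊆cls = from (∈-cls E₂) ∘ E₂′⇒E₂ ∘ to (∈-cls E₂′)
  uY⊆uZ : ¬ ⟦ E₂′ ⟧ x a → upperA E₁ Y ⊆ upperA E₁ Z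
  uY⊆uZ ¬xa′ z∈ =
    let _ , zy , y∈Y = to (∈-upperA E₁) z∈
        ay = Eq₂.trans (Eq₂.sym xa) (E₂′⇒E₂ (to (∈-cls E₂′) y∈Y))
        via ay′ y′z = to R⇔R′ (via ay (Eq₁.sym zy))
        y′∈cls = from (∈-cls E₂) (Eq₂.trans xa (E₂′⇒E₂ ay′))
        y′∉Y = λ y′∈Y → ¬xa′ (Eq₂′.trans (to (∈-cls E₂′) y′∈Y) (Eq₂′.sym ay′))
    in from (∈-upperA E₁) (_ , Eq₁.sym (E₁′⇒E₁ y′z) , x∈p∩q⁺ (y′∈cls , x∉p⇒x∈∁p y′∉Y))
  uZ⊆uY : upperA E₁ Z ⊆ upperA E₁ Y
  uZ⊆uY z∈ =
    let _ , zy , y∈Z = to (∈-upperA E₁) z∈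
        xy = to (∈-cls E₂) (proj₁ (x∈p∩q⁻ (cls E₂ x) (∁ Y) y∈Z))
        via xy′ y′z = to R⇔R′ (via xy (Eq₁.sym zy))
    in from (∈-upperA E₁) (_ , Eq₁.sym (E₁′⇒E₁ y′z) , from (∈-cls E₂′) xy′)

UniqueFirstFactor : BRel n → BRel n → Set
UniqueFirstFactor E₁ E₂ = ∀ {F} → IsEquivalence ⟦ F ⟧ → (E₂ ⨾ E₁) ⇔ᴿ (F ⨾ E₁) → F ≐ E₂

merge : BRel n → Subset n → BRel n
merge E C x y = E x y ∨ (lookup C x ∧ lookup C y)

⟦merge⟧ : (E : BRel n) (C : Subset n) → ⟦ merge E C ⟧ x y ⇔ (⟦ E ⟧ x y ⊎ (x ∈ C × y ∈ C))
⟦merge⟧ E C = mk⇔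
  (λ m → Sum.map (to T-≡) (λ t → let p , q = to T-∧ t in to T-lookup p , to T-lookup q)
                 (to T-∨ (from T-≡ m)))
  (λ s → to T-≡ (from T-∨
           (Sum.map (from T-≡) (λ (p , q) → from T-∧ (from T-lookup p , from T-lookup q)) s)))

isEquivalence-merge : IsEquivalence ⟦ E ⟧ → (∀ {x y} → ⟦ E ⟧ x y → x ∈ C → y ∈ C) →
  IsEquivalence ⟦ merge E C ⟧
isEquivalence-merge {E = E} {C = C} eq closed = record
  { refl  = from (⟦merge⟧ E C) (inj₁ Eq.refl)
  ; sym   = λ m → from (⟦merge⟧ E C) (sym⊎ (to (⟦merge⟧ E C) m))
  ; trans = λ m m′ → from (⟦merge⟧ E C) (trans⊎ (to (⟦merge⟧ E C) m) (to (⟦merge⟧ E C) m′))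
  }
  where
  module Eq = IsEquivalence eq
  sym⊎ : ∀ {x y} → ⟦ E ⟧ x y ⊎ (x ∈ C × y ∈ C) → ⟦ E ⟧ y x ⊎ (y ∈ C × x ∈ C)
  sym⊎ (inj₁ xy)         = inj₁ (Eq.sym xy)
  sym⊎ (inj₂ (x∈ , y∈)) = inj₂ (y∈ , x∈)
  trans⊎ : ∀ {x y z} → ⟦ E ⟧ x y ⊎ (x ∈ C × y ∈ C) → ⟦ E ⟧ y z ⊎ (y ∈ C × z ∈ C) →
    ⟦ E ⟧ x z ⊎ (x ∈ C × z ∈ C)
  trans⊎ (inj₁ xy)        (inj₁ yz)        = inj₁ (Eq.trans xy yz)
  trans⊎ (inj₁ xy)        (inj₂ (y∈ , z∈)) = inj₂ (closed (Eq.sym xy) y∈ , z∈)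
  trans⊎ (inj₂ (x∈ , y∈)) (inj₁ yz)        = inj₂ (x∈ , closed yz y∈)
  trans⊎ (inj₂ (x∈ , _))  (inj₂ (_ , z∈))  = inj₂ (x∈ , z∈)

refine : BRel n → Subset n → BRel n
refine E C x y = E x y ∧ ⌊ lookup C x ≟ lookup C y ⌋

⟦refine⟧ : (E : BRel n) (C : Subset n) → ⟦ refine E C ⟧ x y ⇔ (⟦ E ⟧ x y × (x ∈ C ⇔ y ∈ C))
⟦refine⟧ E C = mk⇔
  (λ r → let p , q = to T-∧ (from T-≡ r) in to T-≡ p , to lookup-≡⇔∈-⇔ (toWitness q))
  (λ (p , q) → to T-≡ (from T-∧ (from T-≡ p , fromWitness (from lookup-≡⇔∈-⇔ q))))

isEquivalence-refine : IsEquivalence ⟦ E ⟧ → IsEquivalence ⟦ refine E C ⟧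
isEquivalence-refine {E = E} {C = C} eq = record
  { refl  = from (⟦refine⟧ E C) (Eq.refl , ⇔.refl)
  ; sym   = λ r → let p , q = to (⟦refine⟧ E C) r in from (⟦refine⟧ E C) (Eq.sym p , ⇔.sym q)
  ; trans = λ r r′ → let p , q = to (⟦refine⟧ E C) r ; p′ , q′ = to (⟦refine⟧ E C) r′
                   in from (⟦refine⟧ E C) (Eq.trans p p′ , ⇔.trans q q′)
  }
  where
  module Eq = IsEquivalence eq
  module ⇔ = IsEquivalence ⇔-isEquivalence

-- Gluing the classes of x and y into one does not change the composite, since their images agree.
separated-of-unique : IsEquivalence ⟦ E₁ ⟧ → IsEquivalence ⟦ E₂ ⟧ →
  UniqueFirstFactor E₁ E₂ → ClassesSeparated E₁ E₂
separated-of-unique {E₁ = E₁} {E₂ = E₂} eq₁ eq₂ unique x y cx≢cy ux≡uy =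
  cx≢cy (related⇒cls≡ eq₂ (trans (sym (merged≐E₂ x y)) (from (⟦merge⟧ E₂ G) (inj₂ (x∈G , y∈G)))))
  where
  module Eq₂ = IsEquivalence eq₂
  G : Subset _
  G = cls E₂ x ∪ cls E₂ y
  x∈G : x ∈ G
  x∈G = x∈p∪q⁺ (inj₁ (from (∈-cls E₂) Eq₂.refl))
  y∈G : y ∈ G
  y∈G = x∈p∪q⁺ (inj₂ (from (∈-cls E₂) Eq₂.refl))
  closed : ∀ {a b} → ⟦ E₂ ⟧ a b → a ∈ G → b ∈ G
  closed ab =
    x∈p∪q⁺ ∘ Sum.map (cls-closed eq₂ ab) (cls-closed eq₂ ab) ∘ x∈p∪q⁻ (cls E₂ x) (cls E₂ y)
  image-on-G : ∀ {a} → a ∈ G → upperA E₁ (cls E₂ a) ≡ upperA E₁ (cls E₂ x)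
  image-on-G a∈ with x∈p∪q⁻ (cls E₂ x) (cls E₂ y) a∈
  ... | inj₁ a∈x = cong (upperA E₁) (sym (related⇒cls≡ eq₂ (to (∈-cls E₂) a∈x)))
  ... | inj₂ a∈y = trans (cong (upperA E₁) (sym (related⇒cls≡ eq₂ (to (∈-cls E₂) a∈y)))) (sym ux≡uy)
  unmerge : (merge E₂ G ⨾ E₁) ⇒ (E₂ ⨾ E₁)
  unmerge (via aw wz) with to (⟦merge⟧ E₂ G) aw
  ... | inj₁ aw′ = via aw′ wz
  ... | inj₂ (a∈G , w∈G) =
    to (∈-upperA-cls eq₁) (subst (_ ∈_) (trans (image-on-G w∈G) (sym (image-on-G a∈G)))
                                 (from (∈-upperA-cls {E₂ = E₂} eq₁) (via Eq₂.refl wz)))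
  premerge : (E₂ ⨾ E₁) ⇒ (merge E₂ G ⨾ E₁)
  premerge (via aw wz) = via (from (⟦merge⟧ E₂ G) (inj₁ aw)) wz
  merged≐E₂ : merge E₂ G ≐ E₂
  merged≐E₂ = unique (isEquivalence-merge eq₂ closed) (mk⇔ premerge unmerge)

-- Refining E₂ by membership in Y does not change the composite: a step crossing from one side
-- of the split class to the other can be rerouted to stay on the first side, as both sides have
-- the same upper approximation.
∉-split-of-unique : IsEquivalence ⟦ E₁ ⟧ → IsEquivalence ⟦ E₂ ⟧ → UniqueFirstFactor E₁ E₂ →
  {Y Z : Subset n} → cls E₂ x ≡ Y ∪ Z → Y ∩ Z ≡ ⊥ → upperA E₁ Y ≡ upperA E₁ Z → x ∉ Y
∉-split-of-unique {E₁ = E₁} {E₂ = E₂} {x = x} eq₁ eq₂ unique {Y} {Z} cls≡Y∪Z Y∩Z≡⊥ uY≡uZ x∈Y =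
  let _ , w∈Z , _ = upperA-≡-witness eq₁ uY≡uZ x∈Y Eq₁.refl
      xw = trans (refined≐E₂ x _) (in-class (inj₂ w∈Z))
  in ∉-disjoint Y∩Z≡⊥ (to (proj₂ (to (⟦refine⟧ E₂ Y) xw)) x∈Y) w∈Z
  where
  module Eq₁ = IsEquivalence eq₁
  module Eq₂ = IsEquivalence eq₂
  in-class : ∀ {y} → y ∈ Y ⊎ y ∈ Z → ⟦ E₂ ⟧ x y
  in-class = to (∈-cls E₂) ∘ subst (_ ∈_) (sym cls≡Y∪Z) ∘ x∈p∪q⁺
  in-Z : ∀ {y} → ⟦ E₂ ⟧ x y → y ∉ Y → y ∈ Z
  in-Z xy y∉Y = [ (λ y∈Y → ⊥-elim (y∉Y y∈Y)) , (λ y∈Z → y∈Z) ]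
    (x∈p∪q⁻ Y Z (subst (_ ∈_) cls≡Y∪Z (from (∈-cls E₂) xy)))
  step : ∀ {a b z} → ⟦ E₂ ⟧ x a → ⟦ E₂ ⟧ x b → (a ∈ Y ⇔ b ∈ Y) → ⟦ E₁ ⟧ b z →
    (refine E₂ Y ⨾ E₁) a z
  step xa xb a⇔b bz = via (from (⟦refine⟧ E₂ Y) (Eq₂.trans (Eq₂.sym xa) xb , a⇔b)) bz
  refine⇐ : (E₂ ⨾ E₁) ⇒ (refine E₂ Y ⨾ E₁)
  refine⇐ {a} (via {w} aw wz) with a ∈? Y | w ∈? Y
  ... | yes a∈Y | yes w∈Y = via (from (⟦refine⟧ E₂ Y) (aw , mk⇔ (λ _ → w∈Y) (λ _ → a∈Y))) wz
  ... | no a∉Y  | no w∉Y  = via (from (⟦refine⟧ E₂ Y) (aw , mk⇔ (⊥-elim ∘ a∉Y) (⊥-elim ∘ w∉Y))) wz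
  ... | yes a∈Y | no w∉Y  =
    let xa = in-class (inj₁ a∈Y)
        w′ , w′∈Y , w′z = upperA-≡-witness eq₁ (sym uY≡uZ) (in-Z (Eq₂.trans xa aw) w∉Y) wz
    in step xa (in-class (inj₁ w′∈Y)) (mk⇔ (λ _ → w′∈Y) (λ _ → a∈Y)) w′z
  ... | no a∉Y  | yes w∈Y =
    let xa = Eq₂.trans (in-class (inj₁ w∈Y)) (Eq₂.sym aw)
        w′ , w′∈Z , w′z = upperA-≡-witness eq₁ uY≡uZ w∈Y wz
        w′∉Y = λ w′∈Y → ∉-disjoint Y∩Z≡⊥ w′∈Y w′∈Z
    in step xa (in-class (inj₂ w′∈Z)) (mk⇔ (⊥-elim ∘ a∉Y) (⊥-elim ∘ w′∉Y)) w′z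
  refine⇒ : (refine E₂ Y ⨾ E₁) ⇒ (E₂ ⨾ E₁)
  refine⇒ (via aw wz) = via (proj₁ (to (⟦refine⟧ E₂ Y) aw)) wz
  refined≐E₂ : refine E₂ Y ≐ E₂
  refined≐E₂ = unique (isEquivalence-refine {C = Y} eq₂) (mk⇔ refine⇐ refine⇒)

unsplittable-of-unique : IsEquivalence ⟦ E₁ ⟧ → IsEquivalence ⟦ E₂ ⟧ →
  UniqueFirstFactor E₁ E₂ → ClassesUnsplittable E₁ E₂
unsplittable-of-unique {E₂ = E₂} eq₁ eq₂ unique x Y Z cls≡Y∪Z Y∩Z≡⊥ uY≡uZ
  with x∈p∪q⁻ Y Z (subst (x ∈_) cls≡Y∪Z (from (∈-cls E₂) (IsEquivalence.refl eq₂)))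
... | inj₁ x∈Y = ∉-split-of-unique eq₁ eq₂ unique cls≡Y∪Z Y∩Z≡⊥ uY≡uZ x∈Y
... | inj₂ x∈Z = ∉-split-of-unique eq₁ eq₂ unique
                   (trans cls≡Y∪Z (∪-comm Y Z)) (trans (∩-comm Z Y) Y∩Z≡⊥) (sym uY≡uZ) x∈Z

DeterminedByLowerA² : BRel n → BRel n → Set
DeterminedByLowerA² {n} E₁ E₂ = (E₁′ E₂′ : BRel n) → IsEquivRel E₁′ → IsEquivRel E₂′ →
  ((X : Subset n) → lowerA E₂′ (lowerA E₁′ X) ≡ lowerA E₂ (lowerA E₁ X)) → (E₁′ ≐ E₁) × (E₂′ ≐ E₂)

unique-of-determined : IsEquivalence ⟦ E₁ ⟧ → IsEquivalence ⟦ E₂ ⟧ → DeterminedByLowerA² E₁ E₂ →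
  UniqueFirstFactor E₁ E₂ × UniqueFirstFactor E₂ E₁
unique-of-determined {E₁ = E₁} {E₂ = E₂} eq₁ eq₂ determined = unique₁₂ , unique₂₁
  where
  unique₁₂ : UniqueFirstFactor E₁ E₂
  unique₁₂ {F} eqF R⇔R_F =
    proj₂ (determined E₁ F (isEquivRel eq₁) (isEquivRel eqF) (⨾-⇔ᴿ⇒lowerA-lowerA-≡ R⇔R_F))
  unique₂₁ : UniqueFirstFactor E₂ E₁
  unique₂₁ {F} eqF Rᵀ⇔R_Fᵀ =
    proj₁ (determined F E₂ (isEquivRel eqF) (isEquivRel eq₂)
            (⨾-⇔ᴿ⇒lowerA-lowerA-≡ (⨾-⇔ᴿ-transpose eq₂ eq₁ eq₂ eqF Rᵀ⇔R_Fᵀ)))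

determined-of-conditions : IsEquivalence ⟦ E₁ ⟧ → IsEquivalence ⟦ E₂ ⟧ →
  ClassesSeparated E₁ E₂ → ClassesSeparated E₂ E₁ →
  ClassesUnsplittable E₁ E₂ → ClassesUnsplittable E₂ E₁ → DeterminedByLowerA² E₁ E₂
determined-of-conditions {E₁ = E₁} {E₂ = E₂}
                         eq₁ eq₂ sep₁₂ sep₂₁ unsplit₁₂ unsplit₂₁ E₁′ E₂′ e₁′ e₂′ L′≡L =
  ⇒-antisym E₁′⇒E₁ E₁⇒E₁′ , ⇒-antisym E₂′⇒E₂ E₂⇒E₂′
  where
  eq₁′ : IsEquivalence ⟦ E₁′ ⟧
  eq₁′ = isEquivalence e₁′
  eq₂′ : IsEquivalence ⟦ E₂′ ⟧
  eq₂′ = isEquivalence e₂′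
  R⇔R′ : (E₂ ⨾ E₁) ⇔ᴿ (E₂′ ⨾ E₁′)
  R⇔R′ = lowerA-lowerA-≡⇒⨾-⇔ᴿ eq₁ eq₁′ L′≡L
  Rᵀ⇔R′ᵀ : (E₁ ⨾ E₂) ⇔ᴿ (E₁′ ⨾ E₂′)
  Rᵀ⇔R′ᵀ = ⨾-⇔ᴿ-transpose eq₁ eq₂ eq₁′ eq₂′ R⇔R′
  E₂′⇒E₂ : ⟦ E₂′ ⟧ ⇒ ⟦ E₂ ⟧
  E₂′⇒E₂ = ⇒-of-separated eq₁ eq₂ eq₂′ R⇔R′ sep₁₂
  E₁′⇒E₁ : ⟦ E₁′ ⟧ ⇒ ⟦ E₁ ⟧
  E₁′⇒E₁ = ⇒-of-separated eq₂ eq₁ eq₁′ Rᵀ⇔R′ᵀ sep₂₁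
  E₂⇒E₂′ : ⟦ E₂ ⟧ ⇒ ⟦ E₂′ ⟧
  E₂⇒E₂′ = ⇐-of-unsplittable eq₁ eq₂ eq₂′ R⇔R′ E₁′⇒E₁ E₂′⇒E₂ unsplit₁₂
  E₁⇒E₁′ : ⟦ E₁ ⟧ ⇒ ⟦ E₁′ ⟧
  E₁⇒E₁′ = ⇐-of-unsplittable eq₂ eq₁ eq₁′ Rᵀ⇔R′ᵀ E₂′⇒E₂ E₁′⇒E₁ unsplit₂₁

mainTheorem14 : (n : ℕ) (E₁ E₂ : BRel n) → IsEquivRel E₁ → IsEquivRel E₂ →
    ((E₁′ E₂′ : BRel n) → IsEquivRel E₁′ → IsEquivRel E₂′ →
        ((X : Subset n) → lowerA E₂′ (lowerA E₁′ X) ≡ lowerA E₂ (lowerA E₁ X)) →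
        (E₁′ ≐ E₁) × (E₂′ ≐ E₂))
    ⇔
    (((x y : Fin n) → cls E₂ x ≢ cls E₂ y → upperA E₁ (cls E₂ x) ≢ upperA E₁ (cls E₂ y))
     × ((x y : Fin n) → cls E₁ x ≢ cls E₁ y → upperA E₂ (cls E₁ x) ≢ upperA E₂ (cls E₁ y))
     × ((x : Fin n) (Y Z : Subset n) → cls E₂ x ≡ Y ∪ Z → Y ∩ Z ≡ ⊥ → upperA E₁ Y ≢ upperA E₁ Z)
     × ((x : Fin n) (Y Z : Subset n) → cls E₁ x ≡ Y ∪ Z → Y ∩ Z ≡ ⊥ → upperA E₂ Y ≢ upperA E₂ Z))
mainTheorem14 n E₁ E₂ e₁ e₂ = mk⇔ necessary sufficient
  where
  eq₁ : IsEquivalence ⟦ E₁ ⟧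
  eq₁ = isEquivalence e₁
  eq₂ : IsEquivalence ⟦ E₂ ⟧
  eq₂ = isEquivalence e₂
  necessary : DeterminedByLowerA² E₁ E₂ → ClassesSeparated E₁ E₂ × ClassesSeparated E₂ E₁ ×
                                         ClassesUnsplittable E₁ E₂ × ClassesUnsplittable E₂ E₁
  necessary determined =
    let unique₁₂ , unique₂₁ = unique-of-determined eq₁ eq₂ determined
    in separated-of-unique eq₁ eq₂ unique₁₂ , separated-of-unique eq₂ eq₁ unique₂₁ ,
       unsplittable-of-unique eq₁ eq₂ unique₁₂ , unsplittable-of-unique eq₂ eq₁ unique₂₁
  sufficient : ClassesSeparated E₁ E₂ × ClassesSeparated E₂ E₁ ×
               ClassesUnsplittable E₁ E₂ × ClassesUnsplittable E₂ E₁ → DeterminedByLowerA² E₁ E₂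
  sufficient (i , ii , iii , iv) = determined-of-conditions eq₁ eq₂ i ii iii iv
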